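{- Let $\emptyset\neq\mathcal{T}\subset\binom{[n]}{3}$ be an intersecting family. Then either $\mathcal{T}$ is isomorphic to one of $\mathcal{L}$ and $\mathcal{T}_0$, or there exist $T\in\mathcal{T}$ and $S\subset T$ with $|S|=2$ and $|\mathcal{T}(\overline{S})|\leq 1$.
   Context: A family is intersecting if any two members intersect. $\mathcal{T}(\overline{S})=\{T\in\mathcal{T}:T\cap S=\emptyset\}$. $\mathcal{L}$ is the Fano plane: $\{1,2,3\},\{1,4,5\},\{1,6,7\},\{2,4,6\},\{2,5,7\},\{3,5,6\},\{3,4,7\}$. $\mathcal{T}_0\subset\binom{[6]}{3}$ is $\{\{1,2,3\},\{1,2,4\},\{3,4,5\},\{3,4,6\},\{1,5,6\},\{2,5,6\},\{1,3,5\},\{2,4,5\},\{1,4,6\},\{2,3,6\}\}$. Isomorphism means equality up to a bijection of the ground set. -}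

module Defs where

open import Data.Nat using (ℕ; _≤_)
open import Data.Bool using (Bool)
import Data.Bool.Properties as BoolP
open import Data.Fin using (Fin; #_)
open import Data.Fin.Subset using (Subset; ⁅_⁆; _∪_; _∩_; _∈_; _⊆_; ∣_∣; Nonempty; ⊥)
open import Data.Vec.Properties using (≡-dec)
open import Data.List using (List; []; _∷_; filter; length)
import Data.List.Membership.Propositional as Mem
open import Data.List.Relation.Unary.Unique.Propositional using (Unique)
open import Data.Product using (Σ; ∃; _×_)
open import Function.Bundles using (_⇔_; _↣_; Injection)
open import Relation.Binary.PropositionalEquality using (_≡_)
open import Relation.Nullary using (Dec)

-- A family of subsets of [n] = Fin n, given as a duplicate-free list.
Family : ℕ → Set
Family n = List (Subset n)

_∈ᶠ_ : ∀ {n} → Subset n → Family n → Set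
_∈ᶠ_ = Mem._∈_

AllTriples : ∀ {n} → Family n → Set
AllTriples {n} 𝒯 = ∀ T → T ∈ᶠ 𝒯 → ∣ T ∣ ≡ 3

Intersecting : ∀ {n} → Family n → Set
Intersecting 𝒯 = ∀ A B → A ∈ᶠ 𝒯 → B ∈ᶠ 𝒯 → Nonempty (A ∩ B)

disjoint? : ∀ {n} (S T : Subset n) → Dec ((T ∩ S) ≡ ⊥)
disjoint? S T = ≡-dec BoolP._≟_ (T ∩ S) ⊥

-- 𝒯(S̄) = {T ∈ 𝒯 : T ∩ S = ∅}
avoiding : ∀ {n} → Family n → Subset n → Family n
avoiding 𝒯 S = filter (disjoint? S) 𝒯

IsImage : ∀ {k n} → (Fin k → Fin n) → Subset k → Subset n → Set
IsImage {k} f L T = ∀ x → (x ∈ T) ⇔ (∃ λ (y : Fin k) → y ∈ L × f y ≡ x)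

-- 𝒯 (on [n]) is isomorphic to ℒ (on [k]): there is an injective relabelling
-- f : [k] → [n] mapping ℒ exactly onto 𝒯 (vertices outside the image of f
-- lie in no member of 𝒯).
Isomorphic : ∀ {n k} → Family n → Family k → Set
Isomorphic {n} {k} 𝒯 ℒ =
  Σ (Fin k ↣ Fin n) λ f →
    ∀ T → T ∈ᶠ 𝒯 ⇔ (∃ λ L → L ∈ᶠ ℒ × IsImage (Injection.to f) L T)

triple : ∀ {n} → Fin n → Fin n → Fin n → Subset n
triple a b c = ⁅ a ⁆ ∪ (⁅ b ⁆ ∪ ⁅ c ⁆)

-- Fano plane on [7] (element i is # (i-1))
Fano : Family 7
Fano = triple (# 0) (# 1) (# 2) ∷ triple (# 0) (# 3) (# 4) ∷ triple (# 0) (# 5) (# 6)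
     ∷ triple (# 1) (# 3) (# 5) ∷ triple (# 1) (# 4) (# 6) ∷ triple (# 2) (# 4) (# 5)
     ∷ triple (# 2) (# 3) (# 6) ∷ []

T₀ : Family 6
T₀ = triple (# 0) (# 1) (# 2) ∷ triple (# 0) (# 1) (# 3) ∷ triple (# 2) (# 3) (# 4)
   ∷ triple (# 2) (# 3) (# 5) ∷ triple (# 0) (# 4) (# 5) ∷ triple (# 1) (# 4) (# 5)
   ∷ triple (# 0) (# 2) (# 4) ∷ triple (# 1) (# 3) (# 4) ∷ triple (# 0) (# 3) (# 5)
   ∷ triple (# 1) (# 2) (# 5) ∷ []

-- Fix a member {a, b, c} of 𝒯. Unless some pair S ⊂ {a, b, c} has |𝒯(S̄)| ≤ 1, each vertex, say a,
-- lies on two further members avoiding the other two vertices; they meet {a, b, c}, hence contain a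
-- ("spokes" at a). If the two spokes at some vertex meet only there, every member through b or c
-- missing a is a transversal of them, and comparing these transversals leaves either a thin pair or
-- the seven lines of a Fano plane. Otherwise the two spokes at each vertex share a second point, the
-- centre of a star. Two equal centres lead to a thin pair or back to the first case, and three
-- distinct centres force the ten members of 𝒯₀. Finally, a family containing a copy of ℒ or 𝒯₀ is
-- isomorphic to it, since both are saturated (every triple meeting all members is a member) and
-- cover every pair of points.

module Submission where

open import Defs
open import Data.Nat using (ℕ; suc; _≤_; _≤?_; z≤n; s≤s)
import Data.Nat.Properties as ℕ
open import Data.Bool using (Bool; true; false)
import Data.Bool.Properties as Bool
open import Data.Fin using (Fin; zero; suc; #_)
open import Data.Fin.Properties using (_≟_; suc-injective; all?; any?)
open import Data.Fin.Subset using (Subset; _∈_; _∉_; _∪_; ⁅_⁆; ∣_∣; _-_; _⊆_; inside; outside)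
open import Data.Fin.Subset.Properties
  using ( _∈?_; x∈p∪q⁻; x∈p∪q⁺; x∈p∩q⁻; x∈p∩q⁺; x∈⁅y⁆⇒x≡y; x∈⁅x⁆; ∣⁅x⁆∣≡1; ∉⊥; ⊆-antisym; p─⊥≡p
        ; x∈p∧x≢y⇒x∈p-y; ∪-assoc; ∪-comm; p⊆q⇒∣p∣≤∣q∣ )
open import Data.Vec using (_∷_; here; there)
open import Data.Vec.Properties using (≡-dec)
open import Data.List using (List; []; _∷_; length; lookup)
open import Data.List.Relation.Unary.All as All using (All; _∷_; [])
open import Data.List.Relation.Unary.Any as Any using (Any; here; there)
open import Data.List.Relation.Unary.AllPairs using (_∷_)
open import Data.List.Relation.Unary.Unique.Propositional using (Unique)
open import Data.List.Relation.Unary.Unique.Propositional.Properties using (filter⁺)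
import Data.List.Membership.Propositional as List
open import Data.List.Membership.Propositional using (find)
open import Data.List.Membership.Propositional.Properties using (∈-filter⁻)
open import Data.Product using (Σ; ∃; ∃₂; _×_; _,_; proj₁; proj₂)
open import Data.Sum using (_⊎_; inj₁; inj₂)
open import Data.Empty using (⊥; ⊥-elim)
open import Function using (_∘_)
open import Function.Bundles using (_⇔_; mk⇔; mk↣; Equivalence)
open import Relation.Nullary using (¬_; yes; no; Dec)
open import Relation.Nullary.Decidable using (_×-dec_; _⊎-dec_; _→-dec_; ¬?; toWitness)
open import Relation.Binary.PropositionalEquality
  using (_≡_; _≢_; refl; sym; trans; cong; subst; ≢-sym; module ≡-Reasoning)

private variable
  k n : ℕ
  a b c v w x y z : Fin n

OneOf : Fin n → Fin n → Fin n → Fin n → Set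
OneOf w a b c = w ≡ a ⊎ w ≡ b ⊎ w ≡ c

∈-triple⁻ : w ∈ triple a b c → OneOf w a b c
∈-triple⁻ {a = a} {b} {c} h with x∈p∪q⁻ ⁅ a ⁆ (⁅ b ⁆ ∪ ⁅ c ⁆) h
... | inj₁ h = inj₁ (x∈⁅y⁆⇒x≡y a h)
... | inj₂ h with x∈p∪q⁻ ⁅ b ⁆ ⁅ c ⁆ h
...   | inj₁ h = inj₂ (inj₁ (x∈⁅y⁆⇒x≡y b h))
...   | inj₂ h = inj₂ (inj₂ (x∈⁅y⁆⇒x≡y c h))

∈-triple⁺ : OneOf w a b c → w ∈ triple a b c
∈-triple⁺ {w = w} (inj₁ refl)        = x∈p∪q⁺ (inj₁ (x∈⁅x⁆ w))
∈-triple⁺ {w = w} (inj₂ (inj₁ refl)) = x∈p∪q⁺ (inj₂ (x∈p∪q⁺ (inj₁ (x∈⁅x⁆ w))))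
∈-triple⁺ {w = w} (inj₂ (inj₂ refl)) = x∈p∪q⁺ (inj₂ (x∈p∪q⁺ (inj₂ (x∈⁅x⁆ w))))

triple-swap₂₃ : (a b c : Fin n) → triple a b c ≡ triple a c b
triple-swap₂₃ a b c = cong (⁅ a ⁆ ∪_) (∪-comm ⁅ b ⁆ ⁅ c ⁆)

triple-swap₁₂ : (a b c : Fin n) → triple a b c ≡ triple b a c
triple-swap₁₂ a b c = begin
  ⁅ a ⁆ ∪ (⁅ b ⁆ ∪ ⁅ c ⁆) ≡⟨ sym (∪-assoc ⁅ a ⁆ ⁅ b ⁆ ⁅ c ⁆) ⟩
  (⁅ a ⁆ ∪ ⁅ b ⁆) ∪ ⁅ c ⁆ ≡⟨ cong (_∪ ⁅ c ⁆) (∪-comm ⁅ a ⁆ ⁅ b ⁆) ⟩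
  (⁅ b ⁆ ∪ ⁅ a ⁆) ∪ ⁅ c ⁆ ≡⟨ ∪-assoc ⁅ b ⁆ ⁅ a ⁆ ⁅ c ⁆ ⟩
  ⁅ b ⁆ ∪ (⁅ a ⁆ ∪ ⁅ c ⁆) ∎
  where open ≡-Reasoning

triple-rotate : (a b c : Fin n) → triple a b c ≡ triple b c a
triple-rotate a b c = trans (triple-swap₁₂ a b c) (triple-swap₂₃ b a c)

x∈p-y⁻ : ∀ {x y : Fin n} {p : Subset n} → x ∈ p - y → x ∈ p × x ≢ y
x∈p-y⁻ {x = zero} {suc y} {inside ∷ p} here = here , λ ()
x∈p-y⁻ {x = suc x} {zero} {s ∷ p} (there h) = there (subst (x ∈_) (p─⊥≡p p) h) , λ ()
x∈p-y⁻ {x = suc x} {suc y} {s ∷ p} (there h) with x∈p-y⁻ {p = p} h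
... | x∈p , x≢y = there x∈p , x≢y ∘ suc-injective

x∈p⇒∣p∣≡1+∣p-x∣ : ∀ {x : Fin n} {p : Subset n} → x ∈ p → ∣ p ∣ ≡ suc ∣ p - x ∣
x∈p⇒∣p∣≡1+∣p-x∣ {x = zero} {inside ∷ p} here = cong (suc ∘ ∣_∣) (sym (p─⊥≡p p))
x∈p⇒∣p∣≡1+∣p-x∣ {x = suc x} {inside ∷ p} (there h) = cong suc (x∈p⇒∣p∣≡1+∣p-x∣ h)
x∈p⇒∣p∣≡1+∣p-x∣ {x = suc x} {outside ∷ p} (there h) = x∈p⇒∣p∣≡1+∣p-x∣ h

x∈p⇒∣p∣≢0 : ∀ {x : Fin n} {p : Subset n} → x ∈ p → ∣ p ∣ ≢ 0
x∈p⇒∣p∣≢0 x∈p ∣p∣≡0 with trans (sym (x∈p⇒∣p∣≡1+∣p-x∣ x∈p)) ∣p∣≡0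
... | ()

∣p∣≡1+k⇒∃x∈p : ∀ {k} (p : Subset n) → ∣ p ∣ ≡ suc k → ∃ λ x → x ∈ p × ∣ p - x ∣ ≡ k
∣p∣≡1+k⇒∃x∈p p ∣p∣≡1+k with element p ∣p∣≡1+k
  where
  element : ∀ {n k} (p : Subset n) → ∣ p ∣ ≡ suc k → ∃ λ x → x ∈ p
  element (inside ∷ p) _ = zero , here
  element (outside ∷ p) ∣p∣≡1+k with element p ∣p∣≡1+k
  ... | x , x∈p = suc x , there x∈p
... | x , x∈p = x , x∈p , ℕ.suc-injective (trans (sym (x∈p⇒∣p∣≡1+∣p-x∣ x∈p)) ∣p∣≡1+k)

∣T∣≡3⇒triple : (T : Subset n) → ∣ T ∣ ≡ 3 → ∃ λ x → ∃₂ λ y z → T ≡ triple x y z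
∣T∣≡3⇒triple T ∣T∣≡3 with ∣p∣≡1+k⇒∃x∈p T ∣T∣≡3
... | x , x∈T , e₂ with ∣p∣≡1+k⇒∃x∈p (T - x) e₂
... | y , y∈T-x , e₁ with ∣p∣≡1+k⇒∃x∈p (T - x - y) e₁
... | z , z∈T-x-y , e₀ = x , y , z , ⊆-antisym ⊆xyz xyz⊆
  where
  z∈T-x = proj₁ (x∈p-y⁻ z∈T-x-y)
  ⊆xyz : ∀ {w} → w ∈ T → w ∈ triple x y z
  ⊆xyz {w} w∈T with w ≟ x | w ≟ y | w ≟ z
  ... | yes w≡x | _ | _ = ∈-triple⁺ (inj₁ w≡x)
  ... | no _ | yes w≡y | _ = ∈-triple⁺ (inj₂ (inj₁ w≡y))
  ... | no _ | no _ | yes w≡z = ∈-triple⁺ (inj₂ (inj₂ w≡z))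
  ... | no w≢x | no w≢y | no w≢z =
    ⊥-elim (x∈p⇒∣p∣≢0 (x∈p∧x≢y⇒x∈p-y (x∈p∧x≢y⇒x∈p-y (x∈p∧x≢y⇒x∈p-y w∈T w≢x) w≢y) w≢z) e₀)
  xyz⊆ : ∀ {w} → w ∈ triple x y z → w ∈ T
  xyz⊆ w∈xyz with ∈-triple⁻ w∈xyz
  ... | inj₁ refl = x∈T
  ... | inj₂ (inj₁ refl) = proj₁ (x∈p-y⁻ y∈T-x)
  ... | inj₂ (inj₂ refl) = proj₁ (x∈p-y⁻ z∈T-x)

⁅b⁆∪⁅c⁆-b≡⁅c⁆ : b ≢ c → (⁅ b ⁆ ∪ ⁅ c ⁆) - b ≡ ⁅ c ⁆
⁅b⁆∪⁅c⁆-b≡⁅c⁆ {b = b} {c} b≢c = ⊆-antisym ⊆c c⊆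
  where
  ⊆c : ∀ {w} → w ∈ (⁅ b ⁆ ∪ ⁅ c ⁆) - b → w ∈ ⁅ c ⁆
  ⊆c h with x∈p-y⁻ h
  ... | w∈bc , w≢b with x∈p∪q⁻ ⁅ b ⁆ ⁅ c ⁆ w∈bc
  ...   | inj₁ w∈b = ⊥-elim (w≢b (x∈⁅y⁆⇒x≡y b w∈b))
  ...   | inj₂ w∈c = w∈c
  c⊆ : ∀ {w} → w ∈ ⁅ c ⁆ → w ∈ (⁅ b ⁆ ∪ ⁅ c ⁆) - b
  c⊆ w∈c with x∈⁅y⁆⇒x≡y c w∈c
  ... | refl = x∈p∧x≢y⇒x∈p-y (x∈p∪q⁺ (inj₂ w∈c)) (≢-sym b≢c)

∣⁅b⁆∪⁅c⁆∣≡2 : b ≢ c → ∣ ⁅ b ⁆ ∪ ⁅ c ⁆ ∣ ≡ 2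
∣⁅b⁆∪⁅c⁆∣≡2 {b = b} {c} b≢c = begin
  ∣ ⁅ b ⁆ ∪ ⁅ c ⁆ ∣           ≡⟨ x∈p⇒∣p∣≡1+∣p-x∣ (x∈p∪q⁺ (inj₁ (x∈⁅x⁆ b))) ⟩
  suc ∣ (⁅ b ⁆ ∪ ⁅ c ⁆) - b ∣ ≡⟨ cong (suc ∘ ∣_∣) (⁅b⁆∪⁅c⁆-b≡⁅c⁆ b≢c) ⟩
  suc ∣ ⁅ c ⁆ ∣               ≡⟨ cong suc (∣⁅x⁆∣≡1 c) ⟩
  2                          ∎
  where open ≡-Reasoning

∣triple∣≡3⇒≢ : ∣ triple a b c ∣ ≡ 3 → a ≢ b
∣triple∣≡3⇒≢ {a = a} {c = c} ∣aac∣≡3 refl with subst (_≤ 2) ∣aac∣≡3 ∣aac∣≤2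
  where
  aac-a⊆c : ∀ {w} → w ∈ triple a a c - a → w ∈ ⁅ c ⁆
  aac-a⊆c h with x∈p-y⁻ h
  ... | w∈aac , w≢a with ∈-triple⁻ w∈aac
  ...   | inj₁ w≡a = ⊥-elim (w≢a w≡a)
  ...   | inj₂ (inj₁ w≡a) = ⊥-elim (w≢a w≡a)
  ...   | inj₂ (inj₂ refl) = x∈⁅x⁆ c
  ∣aac∣≤2 : ∣ triple a a c ∣ ≤ 2
  ∣aac∣≤2 = subst (_≤ 2) (sym (x∈p⇒∣p∣≡1+∣p-x∣ {p = triple a a c} (∈-triple⁺ (inj₁ refl))))
              (s≤s (subst (∣ triple a a c - a ∣ ≤_) (∣⁅x⁆∣≡1 c) (p⊆q⇒∣p∣≤∣q∣ aac-a⊆c)))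
... | s≤s (s≤s ())

∣triple∣≡3⇒distinct : ∣ triple a b c ∣ ≡ 3 → a ≢ b × a ≢ c × b ≢ c
∣triple∣≡3⇒distinct {a = a} {b} {c} h =
  ∣triple∣≡3⇒≢ h ,
  ∣triple∣≡3⇒≢ (subst (λ T → ∣ T ∣ ≡ 3) (triple-swap₂₃ a b c) h) ,
  ∣triple∣≡3⇒≢ (subst (λ T → ∣ T ∣ ≡ 3) (triple-rotate a b c) h)

-- Codes in Fin (suc k): suc i stands for the point i of [k], zero for any point outside [k].
Meets : Fin (suc k) → Fin (suc k) → Fin (suc k) → Subset k → Set
Meets u v w L = ∃ λ i → i ∈ L × OneOf (suc i) u v w

Coded : Fin (suc k) → Fin (suc k) → Fin (suc k) → Subset k → Set
Coded (suc i) (suc j) (suc l) L = L ≡ triple i j l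
Coded _ _ _ _ = ⊥

Saturated : Family k → Set
Saturated ℒ = ∀ u v w → All (Meets u v w) ℒ → Any (Coded u v w) ℒ

CoversPairs : Family k → Set
CoversPairs ℒ = ∀ i j → i ≢ j → ∃ λ l → triple i j l ∈ᶠ ℒ

saturated? : (ℒ : Family k) → Dec (Saturated ℒ)
saturated? ℒ = all? λ u → all? λ v → all? λ w → All.all? (meets? u v w) ℒ →-dec Any.any? (coded? u v w) ℒ
  where
  meets? : ∀ u v w (L : Subset _) → Dec (Meets u v w L)
  meets? u v w L = any? λ i → (i ∈? L) ×-dec ((suc i ≟ u) ⊎-dec (suc i ≟ v) ⊎-dec (suc i ≟ w))
  coded? : ∀ u v w (L : Subset _) → Dec (Coded u v w L)
  coded? (suc i) (suc j) (suc l) L = ≡-dec Bool._≟_ L (triple i j l)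
  coded? zero _ _ _ = no λ ()
  coded? (suc i) zero _ _ = no λ ()
  coded? (suc i) (suc j) zero _ = no λ ()

coversPairs? : (ℒ : Family k) → Dec (CoversPairs ℒ)
coversPairs? ℒ = all? λ i → all? λ j → ¬? (i ≟ j) →-dec any? λ l → Any.any? (≡-dec Bool._≟_ (triple i j l)) ℒ

fano-saturated : Saturated Fano
fano-saturated = toWitness {a? = saturated? Fano} _

fano-coversPairs : CoversPairs Fano
fano-coversPairs = toWitness {a? = coversPairs? Fano} _

T₀-saturated : Saturated T₀
T₀-saturated = toWitness {a? = saturated? T₀} _

T₀-coversPairs : CoversPairs T₀
T₀-coversPairs = toWitness {a? = coversPairs? T₀} _

imageTriple : (f : Fin k → Fin n) (i j l : Fin k) → IsImage f (triple i j l) (triple (f i) (f j) (f l))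
imageTriple f i j l w = mk⇔ to from
  where
  to : w ∈ triple (f i) (f j) (f l) → ∃ λ y → y ∈ triple i j l × f y ≡ w
  to h with ∈-triple⁻ h
  ... | inj₁ e = i , ∈-triple⁺ (inj₁ refl) , sym e
  ... | inj₂ (inj₁ e) = j , ∈-triple⁺ (inj₂ (inj₁ refl)) , sym e
  ... | inj₂ (inj₂ e) = l , ∈-triple⁺ (inj₂ (inj₂ refl)) , sym e
  from : (∃ λ y → y ∈ triple i j l × f y ≡ w) → w ∈ triple (f i) (f j) (f l)
  from (y , h , refl) with ∈-triple⁻ h
  ... | inj₁ refl = ∈-triple⁺ (inj₁ refl)
  ... | inj₂ (inj₁ refl) = ∈-triple⁺ (inj₂ (inj₁ refl))
  ... | inj₂ (inj₂ refl) = ∈-triple⁺ (inj₂ (inj₂ refl))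

image-unique : {f : Fin k → Fin n} {L : Subset k} {T U : Subset n} → IsImage f L T → IsImage f L U → T ≡ U
image-unique T≅ U≅ =
  ⊆-antisym (λ {w} h → Equivalence.from (U≅ w) (Equivalence.to (T≅ w) h))
            (λ {w} h → Equivalence.from (T≅ w) (Equivalence.to (U≅ w) h))

module _ {𝒯 : Family n} (allTriples : AllTriples 𝒯) (intersecting : Intersecting 𝒯) where

  EmbedsInto : (Fin k → Fin n) → Family k → Set
  EmbedsInto f ℒ = All (λ L → ∃ λ T → T ∈ᶠ 𝒯 × IsImage f L T) ℒ

  saturated⇒isomorphic : (ℒ : Family k) → Saturated ℒ → CoversPairs ℒ → (f : Fin k → Fin n) → EmbedsInto f ℒ → Isomorphic 𝒯 ℒ
  saturated⇒isomorphic {k} ℒ saturated covers f embeds = mk↣ injective , λ T → mk⇔ (to T) (from T)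
    where
    -- If f identified two points of a member of ℒ, the image of that member would have fewer than three points.
    injective : ∀ {i j} → f i ≡ f j → i ≡ j
    injective {i} {j} fi≡fj with i ≟ j
    ... | yes i≡j = i≡j
    ... | no i≢j with covers i j i≢j
    ...   | l , L∈ℒ with All.lookup embeds L∈ℒ
    ...     | T , T∈𝒯 , image =
      ⊥-elim (∣triple∣≡3⇒≢ (subst (λ U → ∣ U ∣ ≡ 3) (image-unique image (imageTriple f i j l)) (allTriples T T∈𝒯)) fi≡fj)

    code : (w : Fin n) → Σ (Fin (suc k)) λ c → ∀ i → c ≡ suc i ⇔ f i ≡ w
    code w with any? (λ i → f i ≟ w)
    ... | yes (i , fi≡w) = suc i , λ { j → mk⇔ (λ { refl → fi≡w }) (λ fj≡w → cong suc (injective (trans fi≡w (sym fj≡w)))) }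
    ... | no ∄i = zero , λ i → mk⇔ (λ ()) (λ fi≡w → ⊥-elim (∄i (i , fi≡w)))

    from : ∀ T → (∃ λ L → L ∈ᶠ ℒ × IsImage f L T) → T ∈ᶠ 𝒯
    from T (L , L∈ℒ , image) with All.lookup embeds L∈ℒ
    ... | U , U∈𝒯 , imageU = subst (_∈ᶠ 𝒯) (image-unique imageU image) U∈𝒯

    to : ∀ T → T ∈ᶠ 𝒯 → ∃ λ L → L ∈ᶠ ℒ × IsImage f L T
    to T T∈𝒯 with ∣T∣≡3⇒triple T (allTriples T T∈𝒯)
    ... | x , y , z , refl with code x | code y | code z
    ... | cx , cx⇔ | cy , cy⇔ | cz , cz⇔ = L , L∈ℒ , coded⇒image cx cy cz cx⇔ cy⇔ cz⇔ codedL
      where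
      meets : ∀ {L} → L ∈ᶠ ℒ → Meets cx cy cz L
      meets L∈ℒ with All.lookup embeds L∈ℒ
      ... | U , U∈𝒯 , image with intersecting _ U T∈𝒯 U∈𝒯
      ... | w , w∈T∩U with x∈p∩q⁻ (triple x y z) U w∈T∩U
      ... | w∈T , w∈U with Equivalence.to (image w) w∈U
      ... | i , i∈L , refl = i , i∈L , code-of (∈-triple⁻ w∈T)
        where
        code-of : OneOf (f i) x y z → OneOf (suc i) cx cy cz
        code-of (inj₁ e) = inj₁ (sym (Equivalence.from (cx⇔ i) e))
        code-of (inj₂ (inj₁ e)) = inj₂ (inj₁ (sym (Equivalence.from (cy⇔ i) e)))
        code-of (inj₂ (inj₂ e)) = inj₂ (inj₂ (sym (Equivalence.from (cz⇔ i) e)))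
      found = find (saturated cx cy cz (All.tabulate meets))
      L = proj₁ found
      L∈ℒ = proj₁ (proj₂ found)
      codedL = proj₂ (proj₂ found)
      coded⇒image : ∀ {x y z L} cx cy cz → (∀ i → cx ≡ suc i ⇔ f i ≡ x) → (∀ i → cy ≡ suc i ⇔ f i ≡ y) → (∀ i → cz ≡ suc i ⇔ f i ≡ z)
        → Coded cx cy cz L → IsImage f L (triple x y z)
      coded⇒image (suc i) (suc j) (suc l) cx⇔ cy⇔ cz⇔ refl
        with Equivalence.to (cx⇔ i) refl | Equivalence.to (cy⇔ j) refl | Equivalence.to (cz⇔ l) refl
      ... | refl | refl | refl = imageTriple f i j l

  embedTriple : (f : Fin k → Fin n) (i j l : Fin k) → triple (f i) (f j) (f l) ∈ᶠ 𝒯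
    → ∃ λ T → T ∈ᶠ 𝒯 × IsImage f (triple i j l) T
  embedTriple f i j l m = _ , m , imageTriple f i j l

  fano-iso : ∀ {x₀ x₁ x₂ x₃ x₄ x₅ x₆}
    → triple x₀ x₁ x₂ ∈ᶠ 𝒯 → triple x₀ x₃ x₄ ∈ᶠ 𝒯 → triple x₀ x₅ x₆ ∈ᶠ 𝒯 → triple x₁ x₃ x₅ ∈ᶠ 𝒯
    → triple x₁ x₄ x₆ ∈ᶠ 𝒯 → triple x₂ x₄ x₅ ∈ᶠ 𝒯 → triple x₂ x₃ x₆ ∈ᶠ 𝒯
    → Isomorphic 𝒯 Fano
  fano-iso {x₀} {x₁} {x₂} {x₃} {x₄} {x₅} {x₆} m₀₁₂ m₀₃₄ m₀₅₆ m₁₃₅ m₁₄₆ m₂₄₅ m₂₃₆ =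
    saturated⇒isomorphic Fano fano-saturated fano-coversPairs f
      ( embedTriple f (# 0) (# 1) (# 2) m₀₁₂ ∷ embedTriple f (# 0) (# 3) (# 4) m₀₃₄
      ∷ embedTriple f (# 0) (# 5) (# 6) m₀₅₆ ∷ embedTriple f (# 1) (# 3) (# 5) m₁₃₅
      ∷ embedTriple f (# 1) (# 4) (# 6) m₁₄₆ ∷ embedTriple f (# 2) (# 4) (# 5) m₂₄₅
      ∷ embedTriple f (# 2) (# 3) (# 6) m₂₃₆ ∷ [])
    where
    f : Fin 7 → Fin n
    f = lookup (x₀ ∷ x₁ ∷ x₂ ∷ x₃ ∷ x₄ ∷ x₅ ∷ x₆ ∷ [])

  T₀-iso : ∀ {x₀ x₁ x₂ x₃ x₄ x₅}
    → triple x₀ x₁ x₂ ∈ᶠ 𝒯 → triple x₀ x₁ x₃ ∈ᶠ 𝒯 → triple x₂ x₃ x₄ ∈ᶠ 𝒯 → triple x₂ x₃ x₅ ∈ᶠ 𝒯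
    → triple x₀ x₄ x₅ ∈ᶠ 𝒯 → triple x₁ x₄ x₅ ∈ᶠ 𝒯 → triple x₀ x₂ x₄ ∈ᶠ 𝒯 → triple x₁ x₃ x₄ ∈ᶠ 𝒯
    → triple x₀ x₃ x₅ ∈ᶠ 𝒯 → triple x₁ x₂ x₅ ∈ᶠ 𝒯
    → Isomorphic 𝒯 T₀
  T₀-iso {x₀} {x₁} {x₂} {x₃} {x₄} {x₅} m₀₁₂ m₀₁₃ m₂₃₄ m₂₃₅ m₀₄₅ m₁₄₅ m₀₂₄ m₁₃₄ m₀₃₅ m₁₂₅ =
    saturated⇒isomorphic T₀ T₀-saturated T₀-coversPairs f
      ( embedTriple f (# 0) (# 1) (# 2) m₀₁₂ ∷ embedTriple f (# 0) (# 1) (# 3) m₀₁₃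
      ∷ embedTriple f (# 2) (# 3) (# 4) m₂₃₄ ∷ embedTriple f (# 2) (# 3) (# 5) m₂₃₅
      ∷ embedTriple f (# 0) (# 4) (# 5) m₀₄₅ ∷ embedTriple f (# 1) (# 4) (# 5) m₁₄₅
      ∷ embedTriple f (# 0) (# 2) (# 4) m₀₂₄ ∷ embedTriple f (# 1) (# 3) (# 4) m₁₃₄
      ∷ embedTriple f (# 0) (# 3) (# 5) m₀₃₅ ∷ embedTriple f (# 1) (# 2) (# 5) m₁₂₅ ∷ [])
    where
    f : Fin 6 → Fin n
    f = lookup (x₀ ∷ x₁ ∷ x₂ ∷ x₃ ∷ x₄ ∷ x₅ ∷ [])

∈triple⇒triple-from : w ∈ triple x y z → ∃₂ λ p q → triple x y z ≡ triple w p q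
∈triple⇒triple-from {x = x} {y} {z} w∈xyz with ∈-triple⁻ w∈xyz
... | inj₁ refl = y , z , refl
... | inj₂ (inj₁ refl) = x , z , triple-swap₁₂ x y z
... | inj₂ (inj₂ refl) = x , y , trans (triple-rotate x y z) (triple-rotate y z x)

two-distinct : {A : Set} (xs : List A) → Unique xs → ¬ (length xs ≤ 1) → ∃₂ λ x y → x ≢ y × x List.∈ xs × y List.∈ xs
two-distinct [] _ ¬≤1 = ⊥-elim (¬≤1 z≤n)
two-distinct (x ∷ []) _ ¬≤1 = ⊥-elim (¬≤1 (s≤s z≤n))
two-distinct (x ∷ y ∷ _) ((x≢y ∷ _) ∷ _) _ = x , y , x≢y , here refl , there (here refl)

≢-both⇒≡ : ∀ {x y z : Bool} → x ≢ z → y ≢ z → x ≡ y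
≢-both⇒≡ x≢z y≢z = trans (Bool.¬-not x≢z) (sym (Bool.¬-not y≢z))

∉⇒≢ : ∀ {x y : Fin n} {U : Subset n} → x ∉ U → y ∈ U → x ≢ y
∉⇒≢ x∉U y∈U refl = x∉U y∈U

pick : Fin n → Fin n → Bool → Fin n
pick x y false = x
pick x y true = y

pick-injective : ∀ {x y : Fin n} {i k} → x ≢ y → pick x y i ≡ pick x y k → i ≡ k
pick-injective {i = false} {false} _ _ = refl
pick-injective {i = false} {true} x≢y x≡y = ⊥-elim (x≢y x≡y)
pick-injective {i = true} {false} x≢y y≡x = ⊥-elim (x≢y (sym y≡x))
pick-injective {i = true} {true} _ _ = refl

pick∈triple : ∀ {a x y : Fin n} i → pick x y i ∈ triple a x y
pick∈triple false = ∈-triple⁺ (inj₂ (inj₁ refl))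
pick∈triple true = ∈-triple⁺ (inj₂ (inj₂ refl))

∈triple⇒pick : ∀ {a x y w : Fin n} → w ∈ triple a x y → w ≡ a ⊎ ∃ λ i → w ≡ pick x y i
∈triple⇒pick w∈axy with ∈-triple⁻ w∈axy
... | inj₁ w≡a = inj₁ w≡a
... | inj₂ (inj₁ w≡x) = inj₂ (false , w≡x)
... | inj₂ (inj₂ w≡y) = inj₂ (true , w≡y)

module _ {𝒯 : Family n} (unique : Unique 𝒯) (allTriples : AllTriples 𝒯) (intersecting : Intersecting 𝒯) where

  Line : Fin n → Fin n → Fin n → Set
  Line a b c = triple a b c ∈ᶠ 𝒯

  HasThinPair : Set
  HasThinPair = ∃ λ T → T ∈ᶠ 𝒯 × (∃ λ S → S ⊆ T × ∣ S ∣ ≡ 2 × length (avoiding 𝒯 S) ≤ 1)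

  Conclusion : Set
  Conclusion = Isomorphic 𝒯 Fano ⊎ Isomorphic 𝒯 T₀ ⊎ HasThinPair

  line-distinct : Line a b c → a ≢ b × a ≢ c × b ≢ c
  line-distinct m = ∣triple∣≡3⇒distinct (allTriples _ m)

  line-swap₁₂ : Line a b c → Line b a c
  line-swap₁₂ {a = a} {b} {c} = subst (_∈ᶠ 𝒯) (triple-swap₁₂ a b c)

  line-swap₂₃ : Line a b c → Line a c b
  line-swap₂₃ {a = a} {b} {c} = subst (_∈ᶠ 𝒯) (triple-swap₂₃ a b c)

  line-rotate : Line a b c → Line b c a
  line-rotate {a = a} {b} {c} = subst (_∈ᶠ 𝒯) (triple-rotate a b c)

  meets : ∀ {U} → Line a b c → U ∈ᶠ 𝒯 → a ∈ U ⊎ b ∈ U ⊎ c ∈ U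
  meets {a = a} {b} {c} {U} m U∈𝒯 with intersecting _ U m U∈𝒯
  ... | w , w∈ with x∈p∩q⁻ (triple a b c) U w∈
  ... | w∈abc , w∈U with ∈-triple⁻ w∈abc
  ... | inj₁ refl = inj₁ w∈U
  ... | inj₂ (inj₁ refl) = inj₂ (inj₁ w∈U)
  ... | inj₂ (inj₂ refl) = inj₂ (inj₂ w∈U)

  third-point : ∀ {U} → Line a b c → U ∈ᶠ 𝒯 → a ∉ U → b ∉ U → c ∈ U
  third-point m U∈𝒯 a∉U b∉U with meets m U∈𝒯
  ... | inj₁ a∈U = ⊥-elim (a∉U a∈U)
  ... | inj₂ (inj₁ b∈U) = ⊥-elim (b∉U b∈U)
  ... | inj₂ (inj₂ c∈U) = c∈U

  record IsSpoke (a b c p q : Fin n) : Set where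
    constructor mkIsSpoke
    field
      line : Line a p q
      b∉ : b ∉ triple a p q
      c∉ : c ∉ triple a p q

  record Spoke (a b c : Fin n) : Set where
    constructor mkSpoke
    field
      {p q} : Fin n
      isSpoke : IsSpoke a b c p q

  record TwoSpokes (a b c : Fin n) : Set where
    constructor mkTwoSpokes
    field
      spoke₁ spoke₂ : Spoke a b c
      distinct : triple a (Spoke.p spoke₁) (Spoke.q spoke₁) ≢ triple a (Spoke.p spoke₂) (Spoke.q spoke₂)

  avoider⇒spoke : ∀ {F} → Line a b c → F ∈ᶠ 𝒯 → b ∉ F → c ∉ F → Σ (Spoke a b c) λ s → F ≡ triple a (Spoke.p s) (Spoke.q s)
  avoider⇒spoke {a = a} {b} {c} {F = F} m F∈𝒯 b∉F c∉F with ∣T∣≡3⇒triple F (allTriples F F∈𝒯)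
  ... | _ , _ , _ , refl with ∈triple⇒triple-from (third-point (line-rotate m) F∈𝒯 b∉F c∉F)
  ... | p , q , F≡apq = mkSpoke (mkIsSpoke (subst (_∈ᶠ 𝒯) F≡apq F∈𝒯) (subst (b ∉_) F≡apq b∉F) (subst (c ∉_) F≡apq c∉F)) , F≡apq

  avoiders⇒twoSpokes : Line a b c → ¬ (length (avoiding 𝒯 (⁅ b ⁆ ∪ ⁅ c ⁆)) ≤ 1) → TwoSpokes a b c
  avoiders⇒twoSpokes {a = a} {b} {c} m ≰1 =
    let F₁ , F₂ , F₁≢F₂ , F₁∈ , F₂∈ = two-distinct (avoiding 𝒯 S) (filter⁺ (disjoint? S) unique) ≰1
        s₁ , F₁≡ = spoke F₁∈
        s₂ , F₂≡ = spoke F₂∈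
    in mkTwoSpokes s₁ s₂ λ e → F₁≢F₂ (trans F₁≡ (trans e (sym F₂≡)))
    where
    S = ⁅ b ⁆ ∪ ⁅ c ⁆
    spoke : ∀ {F} → F List.∈ avoiding 𝒯 S → Σ (Spoke a b c) λ s → F ≡ triple a (Spoke.p s) (Spoke.q s)
    spoke {F} F∈ =
      let F∈𝒯 , F∩S≡∅ = ∈-filter⁻ (disjoint? S) {xs = 𝒯} F∈
          ∉F : ∀ {x} → x ∈ S → x ∉ F
          ∉F {x} x∈S x∈F = ∉⊥ (subst (x ∈_) F∩S≡∅ (x∈p∩q⁺ (x∈F , x∈S)))
      in avoider⇒spoke m F∈𝒯 (∉F (x∈p∪q⁺ (inj₁ (x∈⁅x⁆ b)))) (∉F (x∈p∪q⁺ (inj₂ (x∈⁅x⁆ c))))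

  thin-or-twoSpokes : Line a b c → HasThinPair ⊎ TwoSpokes a b c
  thin-or-twoSpokes {a = a} {b} {c} m with length (avoiding 𝒯 (⁅ b ⁆ ∪ ⁅ c ⁆)) ≤? 1
  ... | yes ≤1 = inj₁ (triple a b c , m , ⁅ b ⁆ ∪ ⁅ c ⁆ , (λ h → x∈p∪q⁺ (inj₂ h)) , ∣⁅b⁆∪⁅c⁆∣≡2 (proj₂ (proj₂ (line-distinct m))) , ≤1)
  ... | no ≰1 = inj₂ (avoiders⇒twoSpokes m ≰1)

  hits-pair : ∀ {a x y z u v} → Line a x y → Line z u v → z ∉ triple a x y → a ∉ triple z u v
    → (∃ λ i → u ≡ pick x y i) ⊎ (∃ λ i → v ≡ pick x y i)
  hits-pair axy zuv z∉axy a∉zuv with meets zuv axy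
  ... | inj₁ z∈axy = ⊥-elim (z∉axy z∈axy)
  ... | inj₂ (inj₁ u∈axy) with ∈triple⇒pick u∈axy
  ...   | inj₁ refl = ⊥-elim (a∉zuv (∈-triple⁺ (inj₂ (inj₁ refl))))
  ...   | inj₂ u≡x∨y = inj₁ u≡x∨y
  hits-pair axy zuv z∉axy a∉zuv | inj₂ (inj₂ v∈axy) with ∈triple⇒pick v∈axy
  ...   | inj₁ refl = ⊥-elim (a∉zuv (∈-triple⁺ (inj₂ (inj₂ refl))))
  ...   | inj₂ v≡x∨y = inj₂ v≡x∨y

  pick-line : ∀ {a x y i k} → Line a x y → k ≢ i → Line a (pick x y i) (pick x y k)
  pick-line {i = false} {false} axy k≢i = ⊥-elim (k≢i refl)
  pick-line {i = false} {true} axy k≢i = axy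
  pick-line {i = true} {false} axy k≢i = line-swap₂₃ axy
  pick-line {i = true} {true} axy k≢i = ⊥-elim (k≢i refl)

  -- A member through b or c that misses a
  -- meets {a, p, q} in X i and {a, r, s} in Y j. Members through b and through c with the same
  -- (i, j) yield a thin pair, with both coordinates different they would be disjoint, and what
  -- remains for two members through b and two through c is the Fano plane.
  module Windmill {a b c p q r s : Fin n} (abc : Line a b c) (σ : IsSpoke a b c p q) (τ : IsSpoke a b c r s)
    (p∉ars : p ∉ triple a r s) (q∉ars : q ∉ triple a r s) where

    open IsSpoke σ renaming (line to apq; b∉ to b∉apq; c∉ to c∉apq)
    open IsSpoke τ renaming (line to ars; b∉ to b∉ars; c∉ to c∉ars)

    X Y : Bool → Fin n
    X = pick p q
    Y = pick r s

    p≢q : p ≢ q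
    p≢q = proj₂ (proj₂ (line-distinct apq))

    r≢s : r ≢ s
    r≢s = proj₂ (proj₂ (line-distinct ars))

    X∉ars : ∀ i → X i ∉ triple a r s
    X∉ars false = p∉ars
    X∉ars true = q∉ars

    apq∩ars≡a : ∀ {w} → w ∈ triple a p q → w ∈ triple a r s → w ≡ a
    apq∩ars≡a w∈apq w∈ars with ∈triple⇒pick w∈apq
    ... | inj₁ w≡a = w≡a
    ... | inj₂ (i , refl) = ⊥-elim (X∉ars i w∈ars)

    transversal : ∀ {z u v} → Line z u v → z ∉ triple a p q → z ∉ triple a r s → a ∉ triple z u v
      → ∃₂ λ i j → triple z u v ≡ triple z (X i) (Y j)
    transversal zuv z∉apq z∉ars a∉zuv with hits-pair apq zuv z∉apq a∉zuv | hits-pair ars zuv z∉ars a∉zuv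
    ... | inj₁ (i , refl) | inj₁ (j , u≡Yj) = ⊥-elim (X∉ars i (subst (_∈ triple a r s) (sym u≡Yj) (pick∈triple j)))
    ... | inj₁ (i , refl) | inj₂ (j , refl) = i , j , refl
    ... | inj₂ (i , refl) | inj₁ (j , refl) = i , j , triple-swap₂₃ _ _ _
    ... | inj₂ (i , refl) | inj₂ (j , v≡Yj) = ⊥-elim (X∉ars i (subst (_∈ triple a r s) (sym v≡Yj) (pick∈triple j)))

    b≢c : b ≢ c
    b≢c = proj₂ (proj₂ (line-distinct abc))

    third-of-bc≡a : ∀ {w} → Line b c w → w ≡ a
    third-of-bc≡a bcw = apq∩ars≡a (third-point bcw apq b∉apq c∉apq) (third-point bcw ars b∉ars c∉ars)

    shared-transversal : ∀ {i j} → Line b (X i) (Y j) → Line c (X i) (Y j) → HasThinPair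
    shared-transversal {i} {j} bXY cXY with thin-or-twoSpokes bXY
    ... | inj₁ thin = thin
    ... | inj₂ (mkTwoSpokes σ₁ σ₂ σ₁≢σ₂) = ⊥-elim (σ₁≢σ₂ (trans (spoke≡bca σ₁) (sym (spoke≡bca σ₂))))
      where
      spoke≡bca : (σ : Spoke b (X i) (Y j)) → triple b (Spoke.p σ) (Spoke.q σ) ≡ triple b c a
      spoke≡bca (mkSpoke (mkIsSpoke buw Xi∉ Yj∉)) with ∈-triple⁻ (third-point (line-rotate cXY) buw Xi∉ Yj∉)
      ... | inj₁ c≡b = ⊥-elim (b≢c (sym c≡b))
      ... | inj₂ (inj₁ refl) = cong (triple b c) (third-of-bc≡a buw)
      ... | inj₂ (inj₂ refl) = trans (triple-swap₂₃ b _ c) (cong (triple b c) (third-of-bc≡a (line-swap₂₃ buw)))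

    opposite-transversals : ∀ {i j k l} → Line b (X i) (Y j) → Line c (X k) (Y l) → k ≢ i → l ≢ j → ⊥
    opposite-transversals {i} {j} {k} {l} bXY cXY k≢i l≢j with meets bXY cXY
    ... | inj₁ b∈cXY with ∈-triple⁻ b∈cXY
    ...   | inj₁ b≡c = b≢c b≡c
    ...   | inj₂ (inj₁ b≡Xk) = ∉⇒≢ b∉apq (pick∈triple k) b≡Xk
    ...   | inj₂ (inj₂ b≡Yl) = ∉⇒≢ b∉ars (pick∈triple l) b≡Yl
    opposite-transversals {i} {j} {k} {l} bXY cXY k≢i l≢j | inj₂ (inj₁ Xi∈cXY) with ∈-triple⁻ Xi∈cXY
    ...   | inj₁ Xi≡c = ∉⇒≢ c∉apq (pick∈triple i) (sym Xi≡c)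
    ...   | inj₂ (inj₁ Xi≡Xk) = k≢i (sym (pick-injective p≢q Xi≡Xk))
    ...   | inj₂ (inj₂ Xi≡Yl) = ∉⇒≢ (X∉ars i) (pick∈triple l) Xi≡Yl
    opposite-transversals {i} {j} {k} {l} bXY cXY k≢i l≢j | inj₂ (inj₂ Yj∈cXY) with ∈-triple⁻ Yj∈cXY
    ...   | inj₁ Yj≡c = ∉⇒≢ c∉ars (pick∈triple j) (sym Yj≡c)
    ...   | inj₂ (inj₁ Yj≡Xk) = ∉⇒≢ (X∉ars k) (pick∈triple j) (sym Yj≡Xk)
    ...   | inj₂ (inj₂ Yj≡Yl) = l≢j (sym (pick-injective r≢s Yj≡Yl))

    agree-in-one : ∀ {i j k l} → Line b (X i) (Y j) → Line c (X k) (Y l) → HasThinPair ⊎ (k ≡ i × l ≢ j) ⊎ (k ≢ i × l ≡ j)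
    agree-in-one {i} {j} {k} {l} bXY cXY with k Bool.≟ i | l Bool.≟ j
    ... | yes refl | yes refl = inj₁ (shared-transversal bXY cXY)
    ... | yes k≡i | no l≢j = inj₂ (inj₁ (k≡i , l≢j))
    ... | no k≢i | yes l≡j = inj₂ (inj₂ (k≢i , l≡j))
    ... | no k≢i | no l≢j = ⊥-elim (opposite-transversals bXY cXY k≢i l≢j)

    b-transversals-sharing-X : ∀ {i j₁ j₂ k l} → Line b (X i) (Y j₁) → Line b (X i) (Y j₂) → j₂ ≢ j₁
      → Line c (X k) (Y l) → HasThinPair
    b-transversals-sharing-X {i} B₁ B₂ j₂≢j₁ C with agree-in-one B₁ C
    ... | inj₁ thin = thin
    ... | inj₂ (inj₁ (refl , l≢j₁)) = shared-transversal B₂ (subst (λ l → Line c (X i) (Y l)) (≢-both⇒≡ l≢j₁ j₂≢j₁) C)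
    ... | inj₂ (inj₂ (k≢i , refl)) = ⊥-elim (opposite-transversals B₂ C k≢i (≢-sym j₂≢j₁))

    b-transversals-sharing-Y : ∀ {i₁ i₂ j k l} → Line b (X i₁) (Y j) → Line b (X i₂) (Y j) → i₂ ≢ i₁
      → Line c (X k) (Y l) → HasThinPair
    b-transversals-sharing-Y {j = j} B₁ B₂ i₂≢i₁ C with agree-in-one B₁ C
    ... | inj₁ thin = thin
    ... | inj₂ (inj₁ (refl , l≢j)) = ⊥-elim (opposite-transversals B₂ C (≢-sym i₂≢i₁) l≢j)
    ... | inj₂ (inj₂ (k≢i₁ , refl)) = shared-transversal B₂ (subst (λ k → Line c (X k) (Y j)) (≢-both⇒≡ k≢i₁ i₂≢i₁) C)

    fano : ∀ {i₁ j₁ i₂ j₂} → i₂ ≢ i₁ → j₂ ≢ j₁ → Line b (X i₁) (Y j₁) → Line b (X i₂) (Y j₂)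
      → Line c (X i₂) (Y j₁) → Line c (X i₁) (Y j₂) → Isomorphic 𝒯 Fano
    fano i₂≢i₁ j₂≢j₁ B₁ B₂ C₁ C₂ =
      fano-iso allTriples intersecting abc (pick-line apq i₂≢i₁) (pick-line ars j₂≢j₁) B₁ B₂ C₁ C₂

    crossing-b-transversals : ∀ {i₁ j₁ i₂ j₂ k₁ l₁ k₂ l₂} → i₂ ≢ i₁ → j₂ ≢ j₁
      → Line b (X i₁) (Y j₁) → Line b (X i₂) (Y j₂) → Line c (X k₁) (Y l₁) → Line c (X k₂) (Y l₂)
      → ¬ (k₁ ≡ k₂ × l₁ ≡ l₂) → Conclusion
    crossing-b-transversals {i₁} {j₁} {i₂} {j₂} i₂≢i₁ j₂≢j₁ B₁ B₂ C₁ C₂ C₁≢C₂ with agree-in-one B₁ C₁ | agree-in-one B₁ C₂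
    ... | inj₁ thin | _ = inj₂ (inj₂ thin)
    ... | inj₂ _ | inj₁ thin = inj₂ (inj₂ thin)
    ... | inj₂ (inj₁ (refl , l₁≢j₁)) | inj₂ (inj₁ (refl , l₂≢j₁)) = ⊥-elim (C₁≢C₂ (refl , ≢-both⇒≡ l₁≢j₁ l₂≢j₁))
    ... | inj₂ (inj₂ (k₁≢i₁ , refl)) | inj₂ (inj₂ (k₂≢i₁ , refl)) = ⊥-elim (C₁≢C₂ (≢-both⇒≡ k₁≢i₁ k₂≢i₁ , refl))
    ... | inj₂ (inj₁ (refl , l₁≢j₁)) | inj₂ (inj₂ (k₂≢i₁ , refl)) = inj₁ (fano i₂≢i₁ j₂≢j₁ B₁ B₂
          (subst (λ k → Line c (X k) (Y j₁)) (≢-both⇒≡ k₂≢i₁ i₂≢i₁) C₂) (subst (λ l → Line c (X i₁) (Y l)) (≢-both⇒≡ l₁≢j₁ j₂≢j₁) C₁))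
    ... | inj₂ (inj₂ (k₁≢i₁ , refl)) | inj₂ (inj₁ (refl , l₂≢j₁)) = inj₁ (fano i₂≢i₁ j₂≢j₁ B₁ B₂
          (subst (λ k → Line c (X k) (Y j₁)) (≢-both⇒≡ k₁≢i₁ i₂≢i₁) C₁) (subst (λ l → Line c (X i₁) (Y l)) (≢-both⇒≡ l₂≢j₁ j₂≢j₁) C₂))

    record TwoTransversals (z : Fin n) : Set where
      constructor mkTwoTransversals
      field
        {i₁ j₁ i₂ j₂} : Bool
        line₁ : Line z (X i₁) (Y j₁)
        line₂ : Line z (X i₂) (Y j₂)
        distinct : ¬ (i₁ ≡ i₂ × j₁ ≡ j₂)

    twoTransversals : ∀ {z w} → z ∉ triple a p q → z ∉ triple a r s → TwoSpokes z a w → TwoTransversals z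
    twoTransversals z∉apq z∉ars (mkTwoSpokes (mkSpoke (mkIsSpoke zuv a∉zuv _)) (mkSpoke (mkIsSpoke zuv₂ a∉zuv₂ _)) zuv≢zuv₂)
      with transversal zuv z∉apq z∉ars a∉zuv | transversal zuv₂ z∉apq z∉ars a∉zuv₂
    ... | i₁ , j₁ , e₁ | i₂ , j₂ , e₂ = mkTwoTransversals (subst (_∈ᶠ 𝒯) e₁ zuv) (subst (_∈ᶠ 𝒯) e₂ zuv₂) same⇒≡
      where
      same⇒≡ : ¬ (i₁ ≡ i₂ × j₁ ≡ j₂)
      same⇒≡ (refl , refl) = zuv≢zuv₂ (trans e₁ (sym e₂))

    fano-or-thin : Conclusion
    fano-or-thin with thin-or-twoSpokes (line-swap₁₂ abc) | thin-or-twoSpokes (line-rotate (line-rotate abc))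
    ... | inj₁ thin | _ = inj₂ (inj₂ thin)
    ... | inj₂ _ | inj₁ thin = inj₂ (inj₂ thin)
    ... | inj₂ at-b | inj₂ at-c
      with twoTransversals b∉apq b∉ars at-b | twoTransversals c∉apq c∉ars at-c
    ... | mkTwoTransversals {i₁} {j₁} {i₂} {j₂} B₁ B₂ B₁≢B₂ | mkTwoTransversals C₁ C₂ C₁≢C₂
      with i₂ Bool.≟ i₁ | j₂ Bool.≟ j₁
    ...   | yes refl | yes refl = ⊥-elim (B₁≢B₂ (refl , refl))
    ...   | yes refl | no j₂≢j₁ = inj₂ (inj₂ (b-transversals-sharing-X B₁ B₂ j₂≢j₁ C₁))
    ...   | no i₂≢i₁ | yes refl = inj₂ (inj₂ (b-transversals-sharing-Y B₁ B₂ i₂≢i₁ C₁))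
    ...   | no i₂≢i₁ | no j₂≢j₁ = crossing-b-transversals i₂≢i₁ j₂≢j₁ B₁ B₂ C₁ C₂ C₁≢C₂

  open Windmill using (fano-or-thin)

  isSpoke-swap : IsSpoke a b c x y → IsSpoke a b c y x
  isSpoke-swap {a = a} {x = x} {y} (mkIsSpoke axy b∉ c∉) =
    mkIsSpoke (line-swap₂₃ axy) (subst (_ ∉_) (triple-swap₂₃ a x y) b∉) (subst (_ ∉_) (triple-swap₂₃ a x y) c∉)

  isSpoke-swap₂₃ : IsSpoke a b c x y → IsSpoke a c b x y
  isSpoke-swap₂₃ (mkIsSpoke axy b∉ c∉) = mkIsSpoke axy c∉ b∉

  record Star (a b c : Fin n) : Set where
    constructor mkStar
    field
      {centre leaf₁ leaf₂} : Fin n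
      leaf₁≢leaf₂ : leaf₁ ≢ leaf₂
      spoke₁ : IsSpoke a b c centre leaf₁
      spoke₂ : IsSpoke a b c centre leaf₂

  open Star

  star-swap : Star a b c → Star a c b
  star-swap α = mkStar (leaf₁≢leaf₂ α) (isSpoke-swap₂₃ (spoke₁ α)) (isSpoke-swap₂₃ (spoke₂ α))

  star-of-shared : IsSpoke a b c v x → IsSpoke a b c v y → triple a v x ≢ triple a v y → Star a b c
  star-of-shared {a = a} {v = v} σ₁ σ₂ distinct = mkStar (λ x≡y → distinct (cong (triple a v) x≡y)) σ₁ σ₂

  twoSpokes⇒star : Line a b c → TwoSpokes a b c → Conclusion ⊎ Star a b c
  twoSpokes⇒star {a = a} abc (mkTwoSpokes (mkSpoke {p₁} {q₁} σ₁) (mkSpoke {p₂} {q₂} σ₂) distinct)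
    with p₁ ∈? triple a p₂ q₂ | q₁ ∈? triple a p₂ q₂
  ... | no p₁∉ | no q₁∉ = inj₁ (fano-or-thin abc σ₁ σ₂ p₁∉ q₁∉)
  ... | yes p₁∈ | _ with ∈-triple⁻ p₁∈
  ...   | inj₁ refl = ⊥-elim (proj₁ (line-distinct (IsSpoke.line σ₁)) refl)
  ...   | inj₂ (inj₁ refl) = inj₂ (star-of-shared σ₁ σ₂ distinct)
  ...   | inj₂ (inj₂ refl) = inj₂ (star-of-shared σ₁ (isSpoke-swap σ₂) (λ e → distinct (trans e (triple-swap₂₃ a p₁ p₂))))
  twoSpokes⇒star {a = a} abc (mkTwoSpokes (mkSpoke {p₁} {q₁} σ₁) (mkSpoke {p₂} {q₂} σ₂) distinct)
    | no _ | yes q₁∈ with ∈-triple⁻ q₁∈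
  ...   | inj₁ refl = ⊥-elim (proj₁ (proj₂ (line-distinct (IsSpoke.line σ₁))) refl)
  ...   | inj₂ (inj₁ refl) = inj₂ (star-of-shared (isSpoke-swap σ₁) σ₂ (λ e → distinct (trans (triple-swap₂₃ a p₁ q₁) e)))
  ...   | inj₂ (inj₂ refl) = inj₂ (star-of-shared (isSpoke-swap σ₁) (isSpoke-swap σ₂)
                               (λ e → distinct (trans (triple-swap₂₃ a p₁ q₁) (trans e (triple-swap₂₃ a q₁ p₂)))))

  isSpoke-resp : ∀ {u w} → triple a x y ≡ triple a u w → IsSpoke a b c x y → IsSpoke a b c u w
  isSpoke-resp {b = b} {c} e (mkIsSpoke axy b∉ c∉) = mkIsSpoke (subst (_∈ᶠ 𝒯) e axy) (subst (b ∉_) e b∉) (subst (c ∉_) e c∉)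

  on-spoke : ∀ {w l} → Line a b w → w ≢ c → IsSpoke c a b v l → w ≡ v ⊎ w ≡ l
  on-spoke abw w≢c (mkIsSpoke cvl a∉ b∉) with ∈-triple⁻ (third-point abw cvl a∉ b∉)
  ... | inj₁ w≡c = ⊥-elim (w≢c w≡c)
  ... | inj₂ w≡v∨l = w≡v∨l

  centre-of-star : ∀ {w} → Line a b w → w ≢ c → (γ : Star c a b) → w ≡ centre γ
  centre-of-star abw w≢c (mkStar l₁≢l₂ σ₁ σ₂) with on-spoke abw w≢c σ₁ | on-spoke abw w≢c σ₂
  ... | inj₁ w≡v | _ = w≡v
  ... | inj₂ _ | inj₁ w≡v = w≡v
  ... | inj₂ w≡l₁ | inj₂ w≡l₂ = ⊥-elim (l₁≢l₂ (trans (sym w≡l₁) w≡l₂))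

  crosses-spoke : ∀ {u z l} → IsSpoke c a b v z → IsSpoke a b c u l → v ≢ u → z ≢ u → v ≡ l ⊎ z ≡ l
  crosses-spoke (mkIsSpoke cvz a∉cvz _) (mkIsSpoke aul _ c∉aul) v≢u z≢u with meets cvz aul
  ... | inj₁ c∈aul = ⊥-elim (c∉aul c∈aul)
  ... | inj₂ (inj₁ v∈aul) with ∈-triple⁻ v∈aul
  ...   | inj₁ refl = ⊥-elim (a∉cvz (∈-triple⁺ (inj₂ (inj₁ refl))))
  ...   | inj₂ (inj₁ v≡u) = ⊥-elim (v≢u v≡u)
  ...   | inj₂ (inj₂ v≡l) = inj₁ v≡l
  crosses-spoke (mkIsSpoke cvz a∉cvz _) (mkIsSpoke aul _ c∉aul) v≢u z≢u | inj₂ (inj₂ z∈aul) with ∈-triple⁻ z∈aul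
  ...   | inj₁ refl = ⊥-elim (a∉cvz (∈-triple⁺ (inj₂ (inj₂ refl))))
  ...   | inj₂ (inj₁ z≡u) = ⊥-elim (z≢u z≡u)
  ...   | inj₂ (inj₂ z≡l) = inj₂ z≡l

  star-leaf : ∀ {z} (α : Star a b c) → IsSpoke c a b v z → v ≢ centre α → z ≢ centre α → IsSpoke a b c (centre α) v
  star-leaf (mkStar l₁≢l₂ σ₁ σ₂) τ v≢vα z≢vα with crosses-spoke τ σ₁ v≢vα z≢vα | crosses-spoke τ σ₂ v≢vα z≢vα
  ... | inj₁ refl | _ = σ₁
  ... | inj₂ _ | inj₁ refl = σ₂
  ... | inj₂ z≡l₁ | inj₂ z≡l₂ = ⊥-elim (l₁≢l₂ (trans (sym z≡l₁) z≡l₂))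

  leaf-of-star : (α : Star a b c) (γ : Star c a b) → centre γ ≢ centre α → IsSpoke a b c (centre α) (centre γ)
  leaf-of-star α (mkStar {leaf₁ = z₁} {leaf₂ = z₂} z₁≢z₂ τ₁ τ₂) vγ≢vα with z₁ ≟ centre α
  ... | yes z₁≡vα = star-leaf α τ₂ vγ≢vα (λ z₂≡vα → z₁≢z₂ (trans z₁≡vα (sym z₂≡vα)))
  ... | no z₁≢vα = star-leaf α τ₁ vγ≢vα z₁≢vα

  ∈triple⇒triple-via : ∀ {u w} → b ∈ triple a u w → b ≢ a → ∃ λ t → triple a u w ≡ triple a b t
  ∈triple⇒triple-via {u = u} {w} b∈auw b≢a with ∈-triple⁻ b∈auw
  ... | inj₁ b≡a = ⊥-elim (b≢a b≡a)
  ... | inj₂ (inj₁ refl) = w , refl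
  ... | inj₂ (inj₂ refl) = u , triple-swap₂₃ _ u w

  SpokeOutcome : Fin n → Fin n → Fin n → Fin n → Fin n → Fin n → Fin n → Set
  SpokeOutcome a b c v x vβ vγ = Conclusion ⊎ IsSpoke a v x b vγ ⊎ IsSpoke a v x c vβ

  -- Each of two spokes at a avoiding {v, x} is abc, or passes through b and then through the centre
  -- of γ, or through c and then through the centre of β, or misses b and c and closes a windmill.
  spoke⇒centre-line : Line a b c → (β : Star b a c) (γ : Star c a b) → IsSpoke a b c v x
    → SpokeOutcome a b c v x (centre β) (centre γ)
  spoke⇒centre-line {a = a} {b} {c} {v} {x} abc β γ σ with thin-or-twoSpokes (IsSpoke.line σ)
  ... | inj₁ thin = inj₁ (inj₂ (inj₂ thin))
  ... | inj₂ (mkTwoSpokes (mkSpoke τ₁) (mkSpoke τ₂) distinct) with classify τ₁ | classify τ₂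
    where
    a≢b = proj₁ (line-distinct abc)
    a≢c = proj₁ (proj₂ (line-distinct abc))
    classify : ∀ {u w} → IsSpoke a v x u w → triple a u w ≡ triple a b c ⊎ SpokeOutcome a b c v x (centre β) (centre γ)
    classify {u} {w} τ with b ∈? triple a u w | c ∈? triple a u w
    ... | yes b∈ | _ with ∈triple⇒triple-via b∈ (≢-sym a≢b)
    ...   | t , e with t ≟ c
    ...     | yes refl = inj₁ e
    ...     | no t≢c with centre-of-star (subst (_∈ᶠ 𝒯) e (IsSpoke.line τ)) t≢c γ
    ...       | refl = inj₂ (inj₂ (inj₁ (isSpoke-resp e τ)))
    classify {u} {w} τ | no b∉ | yes c∈ with ∈triple⇒triple-via c∈ (≢-sym a≢c)
    ...   | t , e with centre-of-star (subst (_∈ᶠ 𝒯) e (IsSpoke.line τ)) (λ t≡b → b∉ (subst (b ∈_) (sym e) (∈-triple⁺ (inj₂ (inj₂ (sym t≡b)))))) β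
    ...       | refl = inj₂ (inj₂ (inj₂ (isSpoke-resp e τ)))
    classify {u} {w} τ | no b∉ | no c∉ =
      inj₂ (inj₁ (fano-or-thin abc σ (mkIsSpoke (IsSpoke.line τ) b∉ c∉) (IsSpoke.b∉ τ) (IsSpoke.c∉ τ)))
  ... | inj₁ e₁ | inj₁ e₂ = ⊥-elim (distinct (trans e₁ (sym e₂)))
  ... | inj₂ outcome | _ = outcome
  ... | inj₁ _ | inj₂ outcome = outcome

  avoids-third : ∀ {w} → IsSpoke a v x b w → v ≢ w × x ≢ w
  avoids-third (mkIsSpoke _ v∉abw x∉abw) =
    (λ { refl → v∉abw (∈-triple⁺ (inj₂ (inj₂ refl))) }) , (λ { refl → x∉abw (∈-triple⁺ (inj₂ (inj₂ refl))) })

  equal-centres : Line a b c → (α : Star a b c) (β : Star b a c) (γ : Star c a b) → centre α ≡ centre β → Conclusion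
  equal-centres abc α β γ vα≡vβ with centre γ ≟ centre α
  ... | yes vγ≡vα with spoke⇒centre-line abc β γ (spoke₁ α)
  ...   | inj₁ r = r
  ...   | inj₂ (inj₁ τ) = ⊥-elim (proj₁ (avoids-third τ) (sym vγ≡vα))
  ...   | inj₂ (inj₂ τ) = ⊥-elim (proj₁ (avoids-third τ) vα≡vβ)
  equal-centres abc α β γ vα≡vβ | no vγ≢vα with spoke⇒centre-line abc β γ (leaf-of-star α γ vγ≢vα)
  ...   | inj₁ r = r
  ...   | inj₂ (inj₁ τ) = ⊥-elim (proj₂ (avoids-third τ) refl)
  ...   | inj₂ (inj₂ τ) = ⊥-elim (proj₁ (avoids-third τ) vα≡vβ)

  -- The six spokes between centres, together with the members a b vγ, a c vβ and b c vα produced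
  -- by spoke⇒centre-line, are the members of 𝒯₀ on a, b, c, vγ, vβ, vα.
  distinct-centres : Line a b c → (α : Star a b c) (β : Star b a c) (γ : Star c a b)
    → centre α ≢ centre β → centre α ≢ centre γ → centre β ≢ centre γ → Conclusion
  distinct-centres {a = a} {b} {c} abc α β γ vα≢vβ vα≢vγ vβ≢vγ =
    T₀-of-outcomes (spoke⇒centre-line abc β γ sαβ) (spoke⇒centre-line abc β γ sαγ)
                   (spoke⇒centre-line (line-swap₁₂ abc) α (star-swap γ) sβγ)
    where
    vα = centre α
    vβ = centre β
    vγ = centre γ
    sαβ : IsSpoke a b c vα vβ
    sαβ = isSpoke-swap₂₃ (leaf-of-star (star-swap α) β (≢-sym vα≢vβ))
    sαγ : IsSpoke a b c vα vγ
    sαγ = leaf-of-star α γ (≢-sym vα≢vγ)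
    sβα : IsSpoke b c a vβ vα
    sβα = leaf-of-star (star-swap β) α vα≢vβ
    sβγ : IsSpoke b a c vβ vγ
    sβγ = leaf-of-star β (star-swap γ) (≢-sym vβ≢vγ)
    sγα : IsSpoke c b a vγ vα
    sγα = leaf-of-star (star-swap γ) (star-swap α) vα≢vγ
    sγβ : IsSpoke c a b vγ vβ
    sγβ = leaf-of-star γ (star-swap β) vβ≢vγ
    T₀-of-outcomes : SpokeOutcome a b c vα vβ vβ vγ → SpokeOutcome a b c vα vγ vβ vγ
      → SpokeOutcome b a c vβ vγ vα vγ → Conclusion
    T₀-of-outcomes (inj₁ r) _ _ = r
    T₀-of-outcomes (inj₂ _) (inj₁ r) _ = r
    T₀-of-outcomes (inj₂ _) (inj₂ _) (inj₁ r) = r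
    T₀-of-outcomes (inj₂ (inj₂ τ)) _ _ = ⊥-elim (proj₂ (avoids-third τ) refl)
    T₀-of-outcomes (inj₂ (inj₁ _)) (inj₂ (inj₁ τ)) _ = ⊥-elim (proj₂ (avoids-third τ) refl)
    T₀-of-outcomes (inj₂ (inj₁ _)) (inj₂ (inj₂ _)) (inj₂ (inj₁ τ)) = ⊥-elim (proj₂ (avoids-third τ) refl)
    T₀-of-outcomes (inj₂ (inj₁ ab-vγ)) (inj₂ (inj₂ ac-vβ)) (inj₂ (inj₂ bc-vα)) =
      inj₂ (inj₁ (T₀-iso allTriples intersecting abc (IsSpoke.line ab-vγ) (IsSpoke.line sγβ) (IsSpoke.line sγα)
        (line-swap₂₃ (IsSpoke.line sαβ)) (IsSpoke.line sβα) (IsSpoke.line ac-vβ) (line-swap₂₃ (IsSpoke.line sβγ))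
        (line-swap₂₃ (IsSpoke.line sαγ)) (IsSpoke.line bc-vα)))

  three-stars : Line a b c → Star a b c → Star b a c → Star c a b → Conclusion
  three-stars {a = a} {b} {c} abc α β γ with centre α ≟ centre β
  ... | yes vα≡vβ = equal-centres abc α β γ vα≡vβ
  ... | no vα≢vβ with centre α ≟ centre γ
  ...   | yes vα≡vγ = equal-centres (line-swap₂₃ abc) (star-swap α) γ β vα≡vγ
  ...   | no vα≢vγ with centre β ≟ centre γ
  ...     | yes vβ≡vγ = equal-centres (line-rotate abc) (star-swap β) (star-swap γ) α vβ≡vγ
  ...     | no vβ≢vγ = distinct-centres abc α β γ vα≢vβ vα≢vγ vβ≢vγ

  star-or-conclusion : Line a b c → Conclusion ⊎ Star a b c
  star-or-conclusion abc with thin-or-twoSpokes abc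
  ... | inj₁ thin = inj₁ (inj₂ (inj₂ thin))
  ... | inj₂ spokes = twoSpokes⇒star abc spokes

  conclusion : ∀ {T} → T ∈ᶠ 𝒯 → Conclusion
  conclusion {T} T∈𝒯 with ∣T∣≡3⇒triple T (allTriples T T∈𝒯)
  ... | a , b , c , refl
    with star-or-conclusion T∈𝒯 | star-or-conclusion (line-swap₁₂ T∈𝒯) | star-or-conclusion (line-rotate (line-rotate T∈𝒯))
  ...   | inj₁ r | _ | _ = r
  ...   | inj₂ _ | inj₁ r | _ = r
  ...   | inj₂ _ | inj₂ _ | inj₁ r = r
  ...   | inj₂ α | inj₂ β | inj₂ γ = three-stars T∈𝒯 α β γ

lemma3p1 : (n : ℕ) (𝒯 : Family n) → Unique 𝒯 → 𝒯 ≢ [] → AllTriples 𝒯 → Intersecting 𝒯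
    → Isomorphic 𝒯 Fano ⊎ Isomorphic 𝒯 T₀
    ⊎ (∃ λ (T : Subset n) → T ∈ᶠ 𝒯 × (∃ λ (S : Subset n) → S ⊆ T × ∣ S ∣ ≡ 2 × length (avoiding 𝒯 S) ≤ 1))
lemma3p1 n [] _ []≢[] _ _ = ⊥-elim ([]≢[] refl)
lemma3p1 n (T ∷ _) unique _ allTriples intersecting = conclusion unique allTriples intersecting (here refl)
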